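{- Let $\Pi$ be a strongly $\lambda$-extendible property on a graph class $\mathcal{G}$ with $\lambda=\frac{1}{2}$. Suppose $\Pi$ is hereditary and $G\notin\Pi$ for every $G\in\mathcal{G}$ with $U(G)=K_3$. Then $\Pi=\{G\in\mathcal{G}: G \text{ is bipartite}\}$.
   Context: $\mathcal{G}$ is a class of graphs whose edges may carry orientations and/or labels from a finite set. For $G\in\mathcal{G}$, $U(G)$ denotes the underlying simple graph; subgraphs inherit orientations/labels; $G$ is bipartite if $U(G)$ is. A graph property $\Pi$ is a subset of $\mathcal{G}$ closed under isomorphism; it is hereditary if every vertex-induced subgraph of a graph in $\Pi$ is in $\Pi$. For $\lambda\in(0,1)$, $\Pi$ is strongly $\lambda$-extendible if: (inclusiveness) every $G\in\mathcal{G}$ with $U(G)\in\{K_1,K_2\}$ is in $\Pi$; (block additivity) $G\in\Pi$ iff every block of $G$ is in $\Pi$; (strong $\lambda$-subgraph extension) for every $G\in\mathcal{G}$ and every partition $(U,W)$ of $V(G)$ with $G[U],G[W]\in\Pi$, there is a set $F$ of edges between $U$ and $W$ with $|F|\geq\lambda|E(U,W)|$ such that $G-(E(U,W)\setminus F)\in\Pi$. -}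

module Defs where

open import Data.Nat using (ℕ; zero; suc; _+_; _*_; _≤_)
open import Data.Bool using (Bool; true; false; if_then_else_; _∧_; not)
open import Data.Fin using (Fin; zero; suc)
open import Data.Fin.Subset using (Subset; _∈_; _⊆_; ∁; _-_; Nonempty)
open import Data.Fin.Permutation using (Permutation′; _⟨$⟩ʳ_)
open import Data.Vec using (Vec; []; _∷_; lookup)
open import Data.Maybe using (Maybe; just; nothing; is-just)
import Data.Maybe as M
open import Data.List using (List; sum; map)
open import Data.Product using (Σ; ∃; _×_; _,_)
open import Data.Unit using (⊤)
import Data.Empty
open import Relation.Binary.PropositionalEquality using (_≡_; refl; sym; trans; cong)
import Data.List as L
import Data.Fin as F

-- An edge carries a "decoration" from the finite set Fin k (labels
-- and/or orientation).  Viewing the edge {i,j} from j instead of i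
-- applies the involution rev (e.g. reversing an orientation; rev = id
-- for unoriented edges).  𝒢 is the class of all finite graphs with
-- decorations of this kind.

record EdgeKind : Set where
  field
    k       : ℕ
    rev     : Fin k → Fin k
    rev-inv : ∀ d → rev (rev d) ≡ d

open EdgeKind public

record Graph (Δ : EdgeKind) (n : ℕ) : Set where
  field
    adj     : Fin n → Fin n → Maybe (Fin (k Δ))
    irrefl  : ∀ i → adj i i ≡ nothing
    sym-adj : ∀ i j → adj j i ≡ M.map (rev Δ) (adj i j)

open Graph public

module _ {Δ : EdgeKind} where

  -- adjacency in the underlying simple graph U(G)
  Adj : ∀ {n} → Graph Δ n → Fin n → Fin n → Set
  Adj G i j = is-just (adj G i j) ≡ true

  -- Vertex-induced subgraphs G[S] for S ⊆ V(G) (vertices of S listed in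
  -- increasing order).

  size : ∀ {n} → Subset n → ℕ
  size []          = zero
  size (true ∷ p)  = suc (size p)
  size (false ∷ p) = size p

  enum : ∀ {n} (p : Subset n) → Fin (size p) → Fin n
  enum (true ∷ p)  zero    = zero
  enum (true ∷ p)  (suc i) = suc (enum p i)
  enum (false ∷ p) i       = suc (enum p i)

  induced : ∀ {n} → Graph Δ n → (S : Subset n) → Graph Δ (size S)
  induced G S = record
    { adj     = λ i j → adj G (enum S i) (enum S j)
    ; irrefl  = λ i → irrefl G (enum S i)
    ; sym-adj = λ i j → sym-adj G (enum S i) (enum S j)
    }

  Property : Set₁
  Property = ∀ {n} → Graph Δ n → Set

  IsoClosed : Property → Set
  IsoClosed Π = ∀ {n} (G H : Graph Δ n) (π : Permutation′ n) →
    (∀ i j → adj H (π ⟨$⟩ʳ i) (π ⟨$⟩ʳ j) ≡ adj G i j) → Π G → Π H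

  Hereditary : Property → Set
  Hereditary Π = ∀ {n} (G : Graph Δ n) (S : Subset n) → Π G → Π (induced G S)

  data Walk {n} (G : Graph Δ n) (S : Subset n) : Fin n → Fin n → Set where
    here : ∀ {i} → i ∈ S → Walk G S i i
    step : ∀ {i l j} → i ∈ S → Adj G i l → Walk G S l j → Walk G S i j

  -- G[S] is connected (the empty graph counts as connected here; it is
  -- only used for G[S] - v below)
  ConnectedIn : ∀ {n} → Graph Δ n → Subset n → Set
  ConnectedIn G S = ∀ i j → i ∈ S → j ∈ S → Walk G S i j

  NoCutVertexIn : ∀ {n} → Graph Δ n → Subset n → Set
  NoCutVertexIn G S = ∀ v → v ∈ S → ConnectedIn G (S - v)

  -- a block: a maximal connected (nonempty) subgraph without a cut vertex
  -- (blocks are induced subgraphs, so they are given by vertex sets)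
  IsBlock : ∀ {n} → Graph Δ n → Subset n → Set
  IsBlock G S =
    Nonempty S × ConnectedIn G S × NoCutVertexIn G S ×
    (∀ T → S ⊆ T → ConnectedIn G T → NoCutVertexIn G T → T ⊆ S)

  sumFin : ∀ n → (Fin n → ℕ) → ℕ
  sumFin zero    f = zero
  sumFin (suc n) f = f zero + sumFin n (λ i → f (suc i))

  -- U is the first part of the partition (U, W) with W = ∁ U.
  -- A set F ⊆ E(U,W) is given by keep : Fin n → Fin n → Bool, where the
  -- edge {u,w} with u ∈ U, w ∈ W is in F iff keep u w = true.
  inU : ∀ {n} → Subset n → Fin n → Bool
  inU U i = lookup U i

  crossEdges : ∀ {n} → Graph Δ n → Subset n → ℕ
  crossEdges {n} G U = sumFin n λ u → sumFin n λ w →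
    if inU U u ∧ not (inU U w) ∧ is-just (adj G u w) then 1 else 0

  keptEdges : ∀ {n} → Graph Δ n → Subset n → (Fin n → Fin n → Bool) → ℕ
  keptEdges {n} G U keep = sumFin n λ u → sumFin n λ w →
    if inU U u ∧ not (inU U w) ∧ is-just (adj G u w) ∧ keep u w then 1 else 0

  survives : ∀ {n} → Subset n → (Fin n → Fin n → Bool) → Fin n → Fin n → Bool
  survives U keep i j with inU U i | inU U j
  ... | true  | true  = true
  ... | false | false = true
  ... | true  | false = keep i j
  ... | false | true  = keep j i

  survives-sym : ∀ {n} (U : Subset n) keep i j →
    survives U keep i j ≡ survives U keep j i
  survives-sym U keep i j with inU U i | inU U j
  ... | true  | true  = refl
  ... | false | false = refl
  ... | true  | false = refl
  ... | false | true  = refl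

  private
    ite-map : ∀ {A B : Set} (f : A → B) b (x : Maybe A) →
      (if b then M.map f x else nothing) ≡ M.map f (if b then x else nothing)
    ite-map f true  x = refl
    ite-map f false x = refl

    ite-nothing : ∀ {A : Set} b (x : Maybe A) → x ≡ nothing →
      (if b then x else nothing) ≡ nothing
    ite-nothing true  x e = e
    ite-nothing false x e = refl

  deleteCross : ∀ {n} → Graph Δ n → Subset n → (Fin n → Fin n → Bool) → Graph Δ n
  deleteCross G U keep = record
    { adj     = λ i j → if survives U keep i j then adj G i j else nothing
    ; irrefl  = λ i → ite-nothing (survives U keep i i) (adj G i i) (irrefl G i)
    ; sym-adj = λ i j →
        trans (cong (λ b → if b then adj G j i else nothing) (survives-sym U keep j i))
        (trans (cong (λ x → if survives U keep i j then x else nothing) (sym-adj G i j))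
               (ite-map (rev Δ) (survives U keep i j) (adj G i j)))
    }

  Inclusive : Property → Set
  Inclusive Π = (∀ (G : Graph Δ 1) → Π G) ×
                (∀ (G : Graph Δ 2) → Adj G zero (suc zero) → Π G)

  BlockAdditive : Property → Set
  BlockAdditive Π = ∀ {n} (G : Graph Δ n) →
    (Π G → ∀ S → IsBlock G S → Π (induced G S)) ×
    ((∀ S → IsBlock G S → Π (induced G S)) → Π G)

  -- |F| ≥ (1/2)|E(U,W)| written as 2|F| ≥ |E(U,W)|
  StrongHalfSubgraphExtension : Property → Set
  StrongHalfSubgraphExtension Π = ∀ {n} (G : Graph Δ n) (U : Subset n) →
    Π (induced G U) → Π (induced G (∁ U)) →
    ∃ λ (keep : Fin n → Fin n → Bool) →
      crossEdges G U ≤ 2 * keptEdges G U keep × Π (deleteCross G U keep)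

  StronglyHalfExtendible : Property → Set
  StronglyHalfExtendible Π =
    Inclusive Π × BlockAdditive Π × StrongHalfSubgraphExtension Π

  UnderlyingK3 : Graph Δ 3 → Set
  UnderlyingK3 G = ∀ i j → (i ≡ j → Data.Empty.⊥) → Adj G i j

  Bipartite : ∀ {n} → Graph Δ n → Set
  Bipartite {n} G = ∃ λ (c : Fin n → Bool) → ∀ i j → Adj G i j → (c i ≡ c j → Data.Empty.⊥)

module Submission where

-- (⇒) Join an apex to an odd cycle of length L in a graph of Π and extend
-- across the cut: at least L/2 apex edges are kept, but two kept edges at
-- consecutive cycle vertices would induce a triangle, so L is even.  With
-- no odd cycles there are no odd closed walks, and colouring each vertex by
-- the parity of walks from the root of its component is proper.
-- (⇐) By induction on the number of vertices and block additivity it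
-- suffices to treat a bipartite block G with G - v ∈ Π.  Hang leaves at a
-- neighbour n₀ of v and extend a copy of v joined to the neighbours of v
-- and to the leaves: the 2-colouring of the result forbids keeping edges of
-- both kinds, and counting forces every edge to a neighbour of v to be kept,
-- so G is an induced subgraph of a graph in Π.

open import Defs
open import Data.Empty using (⊥; ⊥-elim)
open import Data.Product using (_×_; ∃; _,_; proj₁; proj₂)
open import Data.Sum using (_⊎_; inj₁; inj₂; [_,_]′)
open import Data.Nat using (ℕ; zero; suc; _+_; _*_; _∸_; _≤_; _<_; z≤n; s≤s; _≟_; _≤?_; _<?_)
open import Data.Nat.Properties
open import Data.Nat.Induction using (<-rec)
open import Data.Nat.Tactic.RingSolver using (solve-∀)
open import Data.Bool using (Bool; true; false; if_then_else_; _∧_; _∨_; not; _xor_)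
import Data.Bool.Properties as Boolₚ
open import Data.Bool.Properties
  using (not-distribˡ-xor; xor-same; ∨-zeroʳ; ∧-identityʳ; ¬-not; not-involutive; not-injective)
open import Data.Maybe using (Maybe; just; nothing; is-just)
import Data.Maybe as Maybe
open import Data.Fin using (Fin; zero; suc; toℕ; fromℕ<; _↑ˡ_; _↑ʳ_; splitAt)
import Data.Fin.Properties as Finₚ
import Data.Fin.Permutation as Perm
open import Data.Fin.Subset using (Subset; ⊤; ∁; _-_; _∈_; _∉_)
open import Data.Fin.Subset.Properties using (∈⊤; x∈p∧x≢y⇒x∈p-y)
open import Data.Vec using (_∷_; []; lookup; tabulate)
import Data.Vec.Properties as Vecₚ
open import Function.Definitions using (Injective)
open import Relation.Binary using (tri<; tri≈; tri>)
open import Relation.Binary.PropositionalEquality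
open import Relation.Nullary using (¬_; Dec; yes; no)
open import Relation.Nullary.Decidable using (_×-dec_; does; dec-true)

false≢true : false ≢ true
false≢true ()

both-differ : ∀ {x y z : Bool} → x ≢ z → y ≢ z → x ≡ y
both-differ x≢z y≢z = trans (¬-not x≢z) (sym (¬-not y≢z))

xor-not-not : ∀ a b → not a xor not b ≡ a xor b
xor-not-not true  b = refl
xor-not-not false b = not-involutive b

xor-both-flip : ∀ {a b a′ b′ : Bool} → a ≢ b → a′ ≢ b′ → a xor a′ ≡ b xor b′
xor-both-flip {b = b} {b′ = b′} a≢b a′≢b′ rewrite ¬-not a≢b | ¬-not a′≢b′ =
  xor-not-not b b′

xor-cancelˡ : ∀ {a b c : Bool} → a xor b ≡ a xor c → b ≡ c
xor-cancelˡ {false} e = e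
xor-cancelˡ {true}  e = not-injective e

odd : ℕ → Bool
odd zero    = false
odd (suc n) = not (odd n)

odd-+ : ∀ a b → odd (a + b) ≡ odd a xor odd b
odd-+ zero    b = refl
odd-+ (suc a) b = trans (cong not (odd-+ a b)) (not-distribˡ-xor (odd a) (odd b))

odd-double : ∀ a → odd (a + a) ≡ false
odd-double a = trans (odd-+ a a) (xor-same (odd a))

∑ₙ : ℕ → (ℕ → ℕ) → ℕ
∑ₙ zero    b = 0
∑ₙ (suc L) b = b 0 + ∑ₙ L (λ k → b (suc k))

∑ₙ-+ : ∀ L (f g : ℕ → ℕ) → ∑ₙ L (λ k → f k + g k) ≡ ∑ₙ L f + ∑ₙ L g
∑ₙ-+ zero    f g = refl
∑ₙ-+ (suc L) f g =
  trans (cong (f 0 + g 0 +_) (∑ₙ-+ L (λ k → f (suc k)) (λ k → g (suc k))))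
        (interchange (f 0) (g 0) _ _)
  where
  interchange : ∀ a b c d → a + b + (c + d) ≡ a + c + (b + d)
  interchange = solve-∀

∑ₙ-mono : ∀ L (f g : ℕ → ℕ) → (∀ k → k < L → f k ≤ g k) → ∑ₙ L f ≤ ∑ₙ L g
∑ₙ-mono zero    f g le = z≤n
∑ₙ-mono (suc L) f g le =
  +-mono-≤ (le 0 (s≤s z≤n)) (∑ₙ-mono L _ _ (λ k k<L → le (suc k) (s≤s k<L)))

∑ₙ-ones : ∀ L → ∑ₙ L (λ _ → 1) ≡ L
∑ₙ-ones zero    = refl
∑ₙ-ones (suc L) = cong suc (∑ₙ-ones L)

∑ₙ-shift : ∀ L (b : ℕ → ℕ) → ∑ₙ L (λ k → b (suc k)) + b 0 ≡ ∑ₙ L b + b L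
∑ₙ-shift zero    b = refl
∑ₙ-shift (suc L) b = begin
  b 1 + ∑ₙ L (λ k → b (suc (suc k))) + b 0  ≡⟨ cong (_+ b 0) (+-comm (b 1) _) ⟩
  ∑ₙ L (λ k → b (suc (suc k))) + b 1 + b 0  ≡⟨ cong (_+ b 0) (∑ₙ-shift L (λ k → b (suc k))) ⟩
  ∑ₙ L (λ k → b (suc k)) + b (suc L) + b 0  ≡⟨ rotate _ (b (suc L)) (b 0) ⟩
  b 0 + ∑ₙ L (λ k → b (suc k)) + b (suc L)  ∎
  where
  open ≡-Reasoning
  rotate : ∀ x y z → x + y + z ≡ z + x + y
  rotate = solve-∀

cyclic-packing : ∀ L (b : ℕ → ℕ) → b L ≡ b 0 →
  (∀ k → k < L → b k + b (suc k) ≤ 1) → ∑ₙ L b + ∑ₙ L b ≤ L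
cyclic-packing L b closed consecutive = begin
  ∑ₙ L b + ∑ₙ L b                       ≡⟨ cong (∑ₙ L b +_) (sym rotation) ⟩
  ∑ₙ L b + ∑ₙ L (λ k → b (suc k))       ≡⟨ sym (∑ₙ-+ L b (λ k → b (suc k))) ⟩
  ∑ₙ L (λ k → b k + b (suc k))          ≤⟨ ∑ₙ-mono L _ _ consecutive ⟩
  ∑ₙ L (λ _ → 1)                        ≡⟨ ∑ₙ-ones L ⟩
  L                                     ∎
  where
  open ≤-Reasoning
  rotation : ∑ₙ L (λ k → b (suc k)) ≡ ∑ₙ L b
  rotation = +-cancelʳ-≡ (b 0) _ _ (trans (∑ₙ-shift L b) (cong (∑ₙ L b +_) closed))

-- 2x ≤ 2a < a + (1 + a)
odd-exceeds-even : ∀ {a x} → x ≤ a → ¬ (a + suc a ≤ 2 * x)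
odd-exceeds-even {a} {x} x≤a big =
  ≤⇒≯ (*-monoʳ-≤ 2 x≤a) (≤-trans (≤-reflexive (odd-form a)) big)
  where
  odd-form : ∀ a → suc (2 * a) ≡ a + suc a
  odd-form = solve-∀

-- If a + (1 + a) ≤ 2 (b + c) with b ≤ a and c ≤ 1 + a, and one of b, c is 0,
-- then c = 1 + a: an odd budget cannot be met by at most a units counted twice.
half-majority : ∀ {a b c} → b ≤ a → c ≤ suc a → a + suc a ≤ 2 * (b + c) →
  c ≡ 0 ⊎ b ≡ 0 → c ≡ suc a
half-majority {a} {b} b≤a _ budget (inj₁ refl) =
  ⊥-elim (odd-exceeds-even b≤a (subst (λ x → a + suc a ≤ 2 * x) (+-identityʳ b) budget))
half-majority {a} _ c≤1+a budget (inj₂ refl) = ≤-antisym c≤1+a (≮⇒≥ λ c<1+a →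
  odd-exceeds-even (≤-pred c<1+a) budget)

_≡ᵇ_ : ∀ {n} → Fin n → Fin n → Bool
zero  ≡ᵇ zero  = true
zero  ≡ᵇ suc y = false
suc x ≡ᵇ zero  = false
suc x ≡ᵇ suc y = x ≡ᵇ y

≡ᵇ-refl : ∀ {n} (x : Fin n) → (x ≡ᵇ x) ≡ true
≡ᵇ-refl zero    = refl
≡ᵇ-refl (suc x) = ≡ᵇ-refl x

≡ᵇ-sound : ∀ {n} (x y : Fin n) → (x ≡ᵇ y) ≡ true → x ≡ y
≡ᵇ-sound zero    zero    e = refl
≡ᵇ-sound (suc x) (suc y) e = cong suc (≡ᵇ-sound x y e)

≡ᵇ-false : ∀ {n} (x y : Fin n) → x ≢ y → (x ≡ᵇ y) ≡ false
≡ᵇ-false x y x≢y with x ≡ᵇ y in e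
... | false = refl
... | true  = ⊥-elim (x≢y (≡ᵇ-sound x y e))

_∈image_ : ∀ {n L} → Fin n → (Fin L → Fin n) → Bool
_∈image_ {L = zero}  x g = false
_∈image_ {L = suc L} x g = (x ≡ᵇ g zero) ∨ (x ∈image (λ i → g (suc i)))

∈image-sound : ∀ {n L} (g : Fin L → Fin n) x → (x ∈image g) ≡ true → ∃ λ i → g i ≡ x
∈image-sound {L = suc L} g x e with x ≡ᵇ g zero in eq
... | true  = zero , sym (≡ᵇ-sound x (g zero) eq)
... | false = let i , gi≡x = ∈image-sound (λ i → g (suc i)) x e in suc i , gi≡x

∈image-complete : ∀ {n L} (g : Fin L → Fin n) i → (g i ∈image g) ≡ true
∈image-complete g zero    rewrite ≡ᵇ-refl (g zero) = refl
∈image-complete g (suc i) rewrite ∈image-complete (λ i → g (suc i)) i =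
  ∨-zeroʳ (g (suc i) ≡ᵇ g zero)

prefix : ∀ {n} L → (ℕ → Fin n) → Fin L → Fin n
prefix L w i = w (toℕ i)

closed-visits : ∀ {n L} (w : ℕ → Fin n) → w (suc L) ≡ w 0 → ∀ k → k ≤ suc L →
  (w k ∈image prefix (suc L) w) ≡ true
closed-visits {L = L} w closed k k≤L with <-cmp k (suc L)
... | tri< k<L _ _  = subst (λ z → (w z ∈image prefix (suc L) w) ≡ true) (Finₚ.toℕ-fromℕ< k<L)
                            (∈image-complete (prefix (suc L) w) (fromℕ< k<L))
... | tri≈ _ refl _ = subst (λ z → (z ∈image prefix (suc L) w) ≡ true) (sym closed)
                            (∈image-complete (prefix (suc L) w) zero)
... | tri> _ _ L<k  = ⊥-elim (<⇒≱ L<k k≤L)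

first : ∀ {m} → (Fin m → Bool) → Maybe (Fin m)
first {zero}  p = nothing
first {suc m} p = if p zero then just zero else Maybe.map suc (first (λ i → p (suc i)))

first-cong : ∀ {m} {p q : Fin m → Bool} → (∀ a → p a ≡ q a) → first p ≡ first q
first-cong {zero}          e = refl
first-cong {suc m} {p} {q} e
  rewrite e zero | first-cong {p = λ i → p (suc i)} {q = λ i → q (suc i)} (λ i → e (suc i)) = refl

first-sound : ∀ {m} (p : Fin m → Bool) {r} → first p ≡ just r → p r ≡ true
first-sound {suc m} p e with p zero in p0
first-sound {suc m} p refl | true = p0
... | false with first (λ i → p (suc i)) in e′
first-sound {suc m} p refl | false | just r = first-sound (λ i → p (suc i)) e′

first-complete : ∀ {m} (p : Fin m → Bool) {x} → p x ≡ true → first p ≢ nothing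
first-complete {suc m} p px e with p zero in p0
first-complete {suc m} p px () | true
... | false with first (λ i → p (suc i)) in e′
first-complete {suc m} p {zero}  px e | false | nothing = ⊥-elim (false≢true (trans (sym p0) px))
first-complete {suc m} p {suc x} px e | false | nothing = first-complete (λ i → p (suc i)) px e′

𝟙 : Bool → ℕ
𝟙 b = if b then 1 else 0

𝟙-mono : ∀ {a b} → (a ≡ true → b ≡ true) → 𝟙 a ≤ 𝟙 b
𝟙-mono {false} _   = z≤n
𝟙-mono {true}  a⇒b rewrite a⇒b refl = ≤-refl

𝟙≢0 : ∀ {b} → 𝟙 b ≢ 0 → b ≡ true
𝟙≢0 {true}  _  = refl
𝟙≢0 {false} ne = ⊥-elim (ne refl)

∧-split : ∀ {a b} → a ∧ b ≡ true → a ≡ true × b ≡ true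
∧-split {true} b≡true = refl , b≡true

𝟙-∧-full : ∀ {a b} → 𝟙 (a ∧ b) ≡ 𝟙 a → a ≡ true → b ≡ true
𝟙-∧-full {true} {true} _ _ = refl
𝟙-∧-full {true} {false} () _

module Sums (Δ : EdgeKind) where

  ∑ : ∀ n → (Fin n → ℕ) → ℕ
  ∑ = sumFin {Δ}

  ∑-cong : ∀ n {f g : Fin n → ℕ} → (∀ i → f i ≡ g i) → ∑ n f ≡ ∑ n g
  ∑-cong zero    e = refl
  ∑-cong (suc n) e = cong₂ _+_ (e zero) (∑-cong n (λ i → e (suc i)))

  ∑-zero : ∀ n {f : Fin n → ℕ} → (∀ i → f i ≡ 0) → ∑ n f ≡ 0
  ∑-zero zero    e = refl
  ∑-zero (suc n) e = cong₂ _+_ (e zero) (∑-zero n (λ i → e (suc i)))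

  ∑-+ : ∀ n (f g : Fin n → ℕ) → ∑ n (λ i → f i + g i) ≡ ∑ n f + ∑ n g
  ∑-+ zero    f g = refl
  ∑-+ (suc n) f g =
    trans (cong (f zero + g zero +_) (∑-+ n (λ i → f (suc i)) (λ i → g (suc i))))
          (interchange (f zero) (g zero) _ _)
    where
    interchange : ∀ a b c d → a + b + (c + d) ≡ a + c + (b + d)
    interchange = solve-∀

  ∑-mono : ∀ n {f g : Fin n → ℕ} → (∀ i → f i ≤ g i) → ∑ n f ≤ ∑ n g
  ∑-mono zero    le = z≤n
  ∑-mono (suc n) le = +-mono-≤ (le zero) (∑-mono n (λ i → le (suc i)))

  ∑-split : ∀ m k (f : Fin (m + k) → ℕ) →
    ∑ (m + k) f ≡ ∑ m (λ i → f (i ↑ˡ k)) + ∑ k (λ i → f (m ↑ʳ i))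
  ∑-split zero    k f = refl
  ∑-split (suc m) k f =
    trans (cong (f zero +_) (∑-split m k (λ i → f (suc i)))) (sym (+-assoc (f zero) _ _))

  ∑-toℕ : ∀ L (b : ℕ → ℕ) → ∑ L (λ i → b (toℕ i)) ≡ ∑ₙ L b
  ∑-toℕ zero    b = refl
  ∑-toℕ (suc L) b = cong (b 0 +_) (∑-toℕ L (λ k → b (suc k)))

  ∑-tight : ∀ n (f g : Fin n → ℕ) → (∀ i → f i ≤ g i) → ∑ n g ≤ ∑ n f →
    ∀ i → f i ≡ g i
  ∑-tight (suc n) f g le ge zero = ≤-antisym (le zero)
    (+-cancelʳ-≤ (∑ n (λ i → g (suc i))) (g zero) (f zero)
      (≤-trans ge (+-monoʳ-≤ (f zero) (∑-mono n (λ i → le (suc i))))))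
  ∑-tight (suc n) f g le ge (suc i) = ∑-tight n _ _ (λ j → le (suc j))
    (+-cancelˡ-≤ (g zero) (∑ n (λ j → g (suc j))) (∑ n (λ j → f (suc j)))
      (≤-trans ge (+-monoˡ-≤ _ (le zero)))) i

  ∑-witness : ∀ n (f : Fin n → ℕ) → ∑ n f ≢ 0 → ∃ λ i → f i ≢ 0
  ∑-witness zero    f ne = ⊥-elim (ne refl)
  ∑-witness (suc n) f ne with f zero ≟ 0
  ... | no  f0≢0 = zero , f0≢0
  ... | yes f0≡0 =
    let i , fi≢0 = ∑-witness n (λ i → f (suc i)) (λ s≡0 → ne (cong₂ _+_ f0≡0 s≡0))
    in suc i , fi≢0

  ∑-single∧ : ∀ n (a : Fin n) (φ : Fin n → Bool) →
    ∑ n (λ x → 𝟙 ((x ≡ᵇ a) ∧ φ x)) ≡ 𝟙 (φ a)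
  ∑-single∧ (suc n) zero    φ = trans (cong (𝟙 (φ zero) +_) (∑-zero n (λ _ → refl))) (+-identityʳ _)
  ∑-single∧ (suc n) (suc a) φ = ∑-single∧ n a (λ x → φ (suc x))

  ∑-single : ∀ n (a : Fin n) → ∑ n (λ x → 𝟙 (x ≡ᵇ a)) ≡ 1
  ∑-single n a = trans (∑-cong n (λ x → cong 𝟙 (sym (∧-identityʳ (x ≡ᵇ a)))))
                       (∑-single∧ n a (λ _ → true))

  ∑-image : ∀ {n} L (g : Fin L → Fin n) → Injective _≡_ _≡_ g → (φ : Fin n → Bool) →
    ∑ n (λ x → 𝟙 ((x ∈image g) ∧ φ x)) ≡ ∑ L (λ i → 𝟙 (φ (g i)))
  ∑-image {n} zero    g inj φ = ∑-zero n (λ x → refl)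
  ∑-image {n} (suc L) g inj φ = begin
    ∑ n (λ x → 𝟙 ((x ∈image g) ∧ φ x))
      ≡⟨ ∑-cong n split ⟩
    ∑ n (λ x → 𝟙 ((x ≡ᵇ g zero) ∧ φ x) + 𝟙 ((x ∈image g′) ∧ φ x))
      ≡⟨ ∑-+ n _ _ ⟩
    ∑ n (λ x → 𝟙 ((x ≡ᵇ g zero) ∧ φ x)) + ∑ n (λ x → 𝟙 ((x ∈image g′) ∧ φ x))
      ≡⟨ cong₂ _+_ (∑-single∧ n (g zero) φ)
                   (∑-image L g′ (λ e → Finₚ.suc-injective (inj e)) φ) ⟩
    𝟙 (φ (g zero)) + ∑ L (λ i → 𝟙 (φ (g′ i)))
      ∎
    where
    open ≡-Reasoning
    g′ : Fin L → Fin n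
    g′ i = g (suc i)
    g0∉g′ : (g zero ∈image g′) ≡ false
    g0∉g′ with g zero ∈image g′ in e
    ... | false = refl
    ... | true with inj (proj₂ (∈image-sound g′ (g zero) e))
    ... | ()
    split : ∀ x →
      𝟙 ((x ∈image g) ∧ φ x) ≡ 𝟙 ((x ≡ᵇ g zero) ∧ φ x) + 𝟙 ((x ∈image g′) ∧ φ x)
    split x with x ≡ᵇ g zero in x≡g0
    ... | false = refl
    ... | true rewrite ≡ᵇ-sound x (g zero) x≡g0 | g0∉g′ with φ (g zero)
    ...   | true  = refl
    ...   | false = refl

module Graphs (Δ : EdgeKind) where
  open Sums Δ

  Label : Set
  Label = Fin (k Δ)

  is-just-if : ∀ {A : Set} b (x : A) → is-just (if b then just x else nothing) ≡ b
  is-just-if true  x = refl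
  is-just-if false x = refl

  is-just-map : ∀ {A B : Set} (f : A → B) (x : Maybe A) → is-just (Maybe.map f x) ≡ is-just x
  is-just-map f (just x) = refl
  is-just-map f nothing  = refl

  map-rev-involutive : ∀ (x : Maybe Label) → Maybe.map (rev Δ) (Maybe.map (rev Δ) x) ≡ x
  map-rev-involutive (just x) = cong just (rev-inv Δ x)
  map-rev-involutive nothing  = refl

  Adj-sym : ∀ {n} (X : Graph Δ n) {i j} → Adj X i j → Adj X j i
  Adj-sym X {i} {j} a =
    trans (trans (cong is-just (sym-adj X i j)) (is-just-map (rev Δ) (adj X i j))) a

  Adj-irrefl : ∀ {n} (X : Graph Δ n) {i} → ¬ Adj X i i
  Adj-irrefl X {i} a with trans (sym (cong is-just (irrefl X i))) a
  ... | ()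

  Adj⇒≢ : ∀ {n} (X : Graph Δ n) {i j} → Adj X i j → i ≢ j
  Adj⇒≢ X a refl = Adj-irrefl X a

  label : ∀ {n} (X : Graph Δ n) {a b} → Adj X a b → Label
  label X {a} {b} e with adj X a b
  label X {a} {b} e  | just l  = l
  label X {a} {b} () | nothing

  reindex : ∀ {n L} → Graph Δ n → (Fin L → Fin n) → Graph Δ L
  reindex X g = record
    { adj = λ i j → adj X (g i) (g j)
    ; irrefl = λ i → irrefl X (g i)
    ; sym-adj = λ i j → sym-adj X (g i) (g j) }

  -- The cone over X: a new vertex 0 (the apex) joined to each old vertex i
  -- by an edge decorated f i (no edge when f i = nothing).
  coneAdj : ∀ {n} → Graph Δ n → (Fin n → Maybe Label) → Fin (suc n) → Fin (suc n) → Maybe Label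
  coneAdj X f zero    zero    = nothing
  coneAdj X f zero    (suc j) = f j
  coneAdj X f (suc i) zero    = Maybe.map (rev Δ) (f i)
  coneAdj X f (suc i) (suc j) = adj X i j

  cone : ∀ {n} → Graph Δ n → (Fin n → Maybe Label) → Graph Δ (suc n)
  cone X f = record { adj = coneAdj X f ; irrefl = irr ; sym-adj = symm }
    where
    irr : ∀ i → coneAdj X f i i ≡ nothing
    irr zero    = refl
    irr (suc i) = irrefl X i
    symm : ∀ i j → coneAdj X f j i ≡ Maybe.map (rev Δ) (coneAdj X f i j)
    symm zero    zero    = refl
    symm zero    (suc j) = refl
    symm (suc i) zero    = sym (map-rev-involutive (f i))
    symm (suc i) (suc j) = sym-adj X i j

  cone-cong : ∀ {n} (X : Graph Δ n) {f g : Fin n → Maybe Label} → (∀ j → f j ≡ g j) →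
    ∀ i j → coneAdj X f i j ≡ coneAdj X g i j
  cone-cong X e zero    zero    = refl
  cone-cong X e zero    (suc j) = e j
  cone-cong X e (suc i) zero    = cong (Maybe.map (rev Δ)) (e i)
  cone-cong X e (suc i) (suc j) = refl

  -- restriction preserves bipartiteness (induced G S is reindex G (enum S))
  bipartite-reindex : ∀ {n L} (X : Graph Δ n) (g : Fin L → Fin n) → Bipartite X → Bipartite (reindex X g)
  bipartite-reindex X g (c , proper) = (λ i → c (g i)) , (λ i j a → proper (g i) (g j) a)

  restrict : ∀ {n} → (Fin n → Maybe Label) → (Fin n → Bool) → Fin n → Maybe Label
  restrict f κ i = if κ i then f i else nothing

  subst-zero : ∀ {a b} (p : a ≡ b) → subst Fin (cong suc p) zero ≡ zero
  subst-zero refl = refl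

  subst-suc : ∀ {a b} (p : a ≡ b) (i : Fin a) → subst Fin (cong suc p) (suc i) ≡ suc (subst Fin p i)
  subst-suc refl i = refl

  size⊤ : ∀ m → size {Δ} (⊤ {m}) ≡ m
  size⊤ zero    = refl
  size⊤ (suc m) = cong suc (size⊤ m)

  size∁⊤ : ∀ m → size {Δ} (∁ (⊤ {m})) ≡ 0
  size∁⊤ zero    = refl
  size∁⊤ (suc m) = size∁⊤ m

  enum⊤ : ∀ m (i : Fin (size {Δ} (⊤ {m}))) → enum {Δ} ⊤ i ≡ subst Fin (size⊤ m) i
  enum⊤ (suc m) zero    = sym (subst-zero (size⊤ m))
  enum⊤ (suc m) (suc i) = trans (cong suc (enum⊤ m i)) (sym (subst-suc (size⊤ m) i))

  enum-∈ : ∀ {n} (S : Subset n) (i : Fin (size {Δ} S)) → lookup S (enum {Δ} S i) ≡ true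
  enum-∈ (true  ∷ p) zero    = refl
  enum-∈ (true  ∷ p) (suc i) = enum-∈ p i
  enum-∈ (false ∷ p) i       = enum-∈ p i

  enum-injective : ∀ {n} (S : Subset n) → Injective _≡_ _≡_ (enum {Δ} S)
  enum-injective (true  ∷ p) {zero}  {zero}  e = refl
  enum-injective (true  ∷ p) {suc i} {suc j} e = cong suc (enum-injective p (Finₚ.suc-injective e))
  enum-injective (false ∷ p) e = enum-injective p (Finₚ.suc-injective e)

  size-tabulate : ∀ n (h : Fin n → Bool) → size {Δ} (tabulate h) ≡ ∑ n (λ x → 𝟙 (h x))
  size-tabulate zero    h = refl
  size-tabulate (suc n) h with h zero
  ... | true  = cong suc (size-tabulate n (λ x → h (suc x)))
  ... | false = size-tabulate n (λ x → h (suc x))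

  size≤ : ∀ {n} (S : Subset n) → size {Δ} S ≤ n
  size≤ []          = z≤n
  size≤ (true  ∷ S) = s≤s (size≤ S)
  size≤ (false ∷ S) = m≤n⇒m≤1+n (size≤ S)

  size-full : ∀ {n} (S : Subset n) → size {Δ} S ≡ n → S ≡ ⊤
  size-full []          e = refl
  size-full (true  ∷ S) e = cong (true ∷_) (size-full S (suc-injective e))
  size-full (false ∷ S) e = ⊥-elim (<-irrefl e (s≤s (size≤ S)))

  pad : ∀ {m} k → Subset m → Subset (k + m)
  pad zero    p = p
  pad (suc k) p = false ∷ pad k p

  size-pad : ∀ {m} k (p : Subset m) → size {Δ} (pad k p) ≡ size {Δ} p
  size-pad zero    p = refl
  size-pad (suc k) p = size-pad k p

  enum-pad : ∀ {m} k (p : Subset m) (i : Fin (size {Δ} (pad k p))) →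
    enum {Δ} (pad k p) i ≡ k ↑ʳ enum {Δ} p (subst Fin (size-pad k p) i)
  enum-pad zero    p i = refl
  enum-pad (suc k) p i = cong suc (enum-pad k p i)

  oldVertices : ∀ m → Subset (suc m)
  oldVertices m = false ∷ ⊤

  lookup⊤ : ∀ {m} (i : Fin m) → lookup (⊤ {m}) i ≡ true
  lookup⊤ i = Vecₚ.lookup-replicate i true

  survives-within : ∀ {n} (U : Subset n) keep i j → inU {Δ} U i ≡ inU {Δ} U j →
    survives {Δ} U keep i j ≡ true
  survives-within U keep i j same with inU {Δ} U i | inU {Δ} U j
  ... | true  | true  = refl
  ... | false | false = refl

  survives-across : ∀ {n} (U : Subset n) keep i j → inU {Δ} U i ≡ true → inU {Δ} U j ≡ false →
    survives {Δ} U keep i j ≡ keep i j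
  survives-across U keep i j i∈U j∉U with inU {Δ} U i | inU {Δ} U j
  survives-across U keep i j refl refl | true | false = refl

  cone-keptEdges : ∀ {m} (X : Graph Δ m) f keep →
    keptEdges (cone X f) (oldVertices m) keep ≡ ∑ m (λ i → 𝟙 (is-just (f i) ∧ keep (suc i) zero))
  cone-keptEdges {m} X f keep = cong₂ _+_ (∑-zero (suc m) (λ _ → refl)) (∑-cong m row)
    where
    row : ∀ i → ∑ (suc m) (λ w → 𝟙 (lookup ⊤ i ∧ not (inU {Δ} (oldVertices m) w) ∧
                                      is-just (coneAdj X f (suc i) w) ∧ keep (suc i) w))
              ≡ 𝟙 (is-just (f i) ∧ keep (suc i) zero)
    row i rewrite lookup⊤ i | is-just-map (rev Δ) (f i) =
      trans (cong (𝟙 (is-just (f i) ∧ keep (suc i) zero) +_)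
                  (∑-zero m (λ j → cong (λ b → 𝟙 (not b ∧ is-just (adj X i j) ∧ keep (suc i) (suc j)))
                                        (lookup⊤ j))))
            (+-identityʳ _)

  cone-crossEdges : ∀ {m} (X : Graph Δ m) f →
    crossEdges (cone X f) (oldVertices m) ≡ ∑ m (λ i → 𝟙 (is-just (f i)))
  cone-crossEdges {m} X f = begin
    crossEdges H U                      ≡⟨ ∑-cong (suc m) (λ u → ∑-cong (suc m) (λ w →
                                             cong (λ b → 𝟙 (inU {Δ} U u ∧ not (inU {Δ} U w) ∧ b))
                                                  (sym (∧-identityʳ (is-just (adj H u w)))))) ⟩
    keptEdges H U (λ _ _ → true)        ≡⟨ cone-keptEdges X f (λ _ _ → true) ⟩
    ∑ m (λ i → 𝟙 (is-just (f i) ∧ true)) ≡⟨ ∑-cong m (λ i → cong 𝟙 (∧-identityʳ (is-just (f i)))) ⟩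
    ∑ m (λ i → 𝟙 (is-just (f i)))       ∎
    where
    open ≡-Reasoning
    H : Graph Δ (suc m)
    H = cone X f
    U : Subset (suc m)
    U = oldVertices m

  cone-deleteCross : ∀ {m} (X : Graph Δ m) f keep i j →
    coneAdj X (restrict f (λ u → keep (suc u) zero)) i j
      ≡ adj (deleteCross (cone X f) (oldVertices m) keep) i j
  cone-deleteCross X f keep zero zero = sym (if-nothing (survives {Δ} (oldVertices _) keep zero zero))
    where
    if-nothing : ∀ b → (if b then nothing else nothing) ≡ nothing {A = Label}
    if-nothing true  = refl
    if-nothing false = refl
  cone-deleteCross X f keep zero (suc j) =
    cong (λ b → if b then f j else nothing)
         (sym (trans (survives-sym {Δ} (oldVertices _) keep zero (suc j))
                     (survives-across (oldVertices _) keep (suc j) zero (lookup⊤ j) refl)))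
  cone-deleteCross X f keep (suc i) zero =
    trans (sym (if-map (keep (suc i) zero) (f i)))
          (cong (λ b → if b then Maybe.map (rev Δ) (f i) else nothing)
                (sym (survives-across (oldVertices _) keep (suc i) zero (lookup⊤ i) refl)))
    where
    if-map : ∀ b (x : Maybe Label) →
      (if b then Maybe.map (rev Δ) x else nothing) ≡ Maybe.map (rev Δ) (if b then x else nothing)
    if-map true  x = refl
    if-map false x = refl
  cone-deleteCross X f keep (suc i) (suc j) =
    cong (λ b → if b then adj X i j else nothing)
         (sym (survives-within (oldVertices _) keep (suc i) (suc j) (trans (lookup⊤ i) (sym (lookup⊤ j)))))

  edgeTo : ∀ {n} → Label → Fin n → Fin n → Maybe Label
  edgeTo d a j = if j ≡ᵇ a then just d else nothing

  -- X with k new leaves (vertices 0 … k-1) hung at the vertex a; the old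
  -- vertex i becomes k ↑ʳ i.
  leaves : ∀ {m} → Graph Δ m → Label → Fin m → ∀ k → Graph Δ (k + m)
  leaves X d a zero    = X
  leaves X d a (suc k) = cone (leaves X d a k) (edgeTo d (k ↑ʳ a))

  leaves-old : ∀ {m} (X : Graph Δ m) d a k (i j : Fin m) →
    adj (leaves X d a k) (k ↑ʳ i) (k ↑ʳ j) ≡ adj X i j
  leaves-old X d a zero    i j = refl
  leaves-old X d a (suc k) i j = leaves-old X d a k i j

  leaves-leaf : ∀ {m} (X : Graph Δ m) d a k (l : Fin k) → Adj (leaves X d a k) (l ↑ˡ m) (k ↑ʳ a)
  leaves-leaf X d a (suc k) zero    rewrite ≡ᵇ-refl (k ↑ʳ a) = refl
  leaves-leaf X d a (suc k) (suc l) = leaves-leaf X d a k l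

  colourings-agree : ∀ {n} (X : Graph Δ n) S (c₁ c₂ : Fin n → Bool) →
    (∀ x y → x ∈ S → y ∈ S → Adj X x y → c₁ x ≢ c₁ y × c₂ x ≢ c₂ y) →
    ConnectedIn X S → ∀ {x y} → x ∈ S → y ∈ S → c₁ x xor c₂ x ≡ c₁ y xor c₂ y
  colourings-agree X S c₁ c₂ proper connected x∈S y∈S = along (connected _ _ x∈S y∈S)
    where
    along : ∀ {a b} → Walk X S a b → c₁ a xor c₂ a ≡ c₁ b xor c₂ b
    along (here _)           = refl
    along (step a∈S al rest) =
      let c₁≢ , c₂≢ = proper _ _ a∈S (start rest) al
      in  trans (xor-both-flip c₁≢ c₂≢) (along rest)
      where
      start : ∀ {i j} → Walk X S i j → i ∈ S
      start (here p)     = p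
      start (step p _ _) = p

module OddWalks (Δ : EdgeKind) where
  open Graphs Δ

  IsWalk : ∀ {n} → Graph Δ n → (ℕ → Fin n) → ℕ → Set
  IsWalk X w L = ∀ k → k < L → Adj X (w k) (w (suc k))

  WalkOf : ∀ {n} → Graph Δ n → ℕ → Fin n → Fin n → Set
  WalkOf X L a b = ∃ λ w → IsWalk X w L × w 0 ≡ a × w L ≡ b

  NoOddClosedWalk : ∀ {n} → Graph Δ n → Set
  NoOddClosedWalk X = ∀ {L a} → WalkOf X L a a → odd L ≡ true → ⊥

  NoOddCycle : ∀ {n} → Graph Δ n → Set
  NoOddCycle X = ∀ L w → IsWalk X w L → w L ≡ w 0 → odd L ≡ true →
    Injective _≡_ _≡_ (prefix L w) → ⊥

  excise : ∀ {n} → (ℕ → Fin n) → ℕ → ℕ → ℕ → Fin n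
  excise w i d k with k ≤? i
  ... | yes _ = w k
  ... | no  _ = w (k + d)

  excise-≤ : ∀ {n} (w : ℕ → Fin n) i d k → k ≤ i → excise w i d k ≡ w k
  excise-≤ w i d k k≤i with k ≤? i
  ... | yes _  = refl
  ... | no k≰i = ⊥-elim (k≰i k≤i)

  excise-> : ∀ {n} (w : ℕ → Fin n) i d k → i < k → excise w i d k ≡ w (k + d)
  excise-> w i d k i<k with k ≤? i
  ... | yes k≤i = ⊥-elim (<⇒≱ i<k k≤i)
  ... | no  _   = refl

  excise-walk : ∀ {n} (X : Graph Δ n) (w : ℕ → Fin n) i d r → w i ≡ w (i + d) →
    IsWalk X w (i + d + r) → WalkOf X (i + r) (w 0) (w (i + d + r))
  excise-walk X w i d r closed walk = excise w i d , steps , excise-≤ w i d 0 z≤n , end r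
    where
    steps : IsWalk X (excise w i d) (i + r)
    steps k k< with <-cmp k i
    ... | tri< k<i _ _ rewrite excise-≤ w i d k (<⇒≤ k<i) | excise-≤ w i d (suc k) k<i =
          walk k (≤-trans k<i (≤-trans (m≤m+n i d) (m≤m+n (i + d) r)))
    ... | tri≈ _ refl _ rewrite excise-≤ w k d k ≤-refl | excise-> w k d (suc k) ≤-refl | closed =
          walk (k + d) (m<m+n (k + d) (positive r k<))
      where
      positive : ∀ r → k < k + r → 0 < r
      positive zero    k<k+0 = ⊥-elim (<-irrefl (sym (+-identityʳ k)) k<k+0)
      positive (suc r) _     = s≤s z≤n
    ... | tri> _ _ i<k rewrite excise-> w i d k i<k | excise-> w i d (suc k) (m<n⇒m<1+n i<k) =
          walk (k + d) (subst (k + d <_) (reorder i r d) (+-monoˡ-< d k<))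
      where
      reorder : ∀ i r d → i + r + d ≡ i + d + r
      reorder = solve-∀
    end : ∀ r → excise w i d (i + r) ≡ w (i + d + r)
    end zero    = trans (excise-≤ w i d (i + 0) (≤-reflexive (+-identityʳ i)))
                        (trans (cong w (+-identityʳ i)) (trans closed (cong w (sym (+-identityʳ (i + d))))))
    end (suc r) = trans (excise-> w i d (i + suc r) (m<m+n i (s≤s z≤n)))
                        (cong w (reorder i r d))
      where
      reorder : ∀ i r d → i + suc r + d ≡ i + d + suc r
      reorder = solve-∀

  record Revisit {n} (X : Graph Δ n) (w : ℕ → Fin n) (L j : ℕ) : Set where
    field
      loop rest  : ℕ
      lengths    : L ≡ loop + rest
      loop-pos   : 1 ≤ loop
      rest-pos   : j < L → 1 ≤ rest
      closedWalk : ∃ λ a → WalkOf X loop a a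
      shortened  : WalkOf X rest (w 0) (w L)

    parity : odd L ≡ odd loop xor odd rest
    parity = trans (cong odd lengths) (odd-+ loop rest)

    rest<L : rest < L
    rest<L = subst (rest <_) (sym lengths) (m<n+m rest loop-pos)

    loop<L : j < L → loop < L
    loop<L j<L = subst (loop <_) (sym lengths) (m<m+n loop (rest-pos j<L))

  revisit : ∀ {n} (X : Graph Δ n) {w L} i j → IsWalk X w L → i < j → j ≤ L → w i ≡ w j →
    Revisit X w L j
  revisit X {w} {L} i j walk i<j j≤L wi≡wj = record
    { loop       = d
    ; rest       = i + r
    ; lengths    = trans (sym whole) (rearrange i d r)
    ; loop-pos   = m<n⇒0<n∸m i<j
    ; rest-pos   = λ j<L → ≤-trans (m<n⇒0<n∸m j<L) (m≤n+m r i)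
    ; closedWalk = w i , (λ k → w (i + k)) , loopSteps , cong w (+-identityʳ i) ,
                   trans (cong w upToJ) (sym wi≡wj)
    ; shortened  = subst (WalkOf X (i + r) (w 0)) (cong w whole)
                     (excise-walk X w i d r (trans wi≡wj (cong w (sym upToJ))) walk′)
    }
    where
    d r : ℕ
    d = j ∸ i
    r = L ∸ j
    upToJ : i + d ≡ j
    upToJ = m+[n∸m]≡n (<⇒≤ i<j)
    whole : i + d + r ≡ L
    whole = trans (cong (_+ r) upToJ) (m+[n∸m]≡n j≤L)
    walk′ : IsWalk X w (i + d + r)
    walk′ = subst (IsWalk X w) (sym whole) walk
    loopSteps : IsWalk X (λ k → w (i + k)) d
    loopSteps k k<d = subst (λ z → Adj X (w (i + k)) (w z)) (sym (+-suc i k))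
      (walk′ (i + k) (≤-trans (+-monoʳ-< i k<d) (m≤m+n (i + d) r)))
    rearrange : ∀ i d r → i + d + r ≡ d + (i + r)
    rearrange = solve-∀

  repeats-or-injective : ∀ {n L} (g : Fin L → Fin n) →
    (∃ λ i → ∃ λ j → toℕ i < toℕ j × g i ≡ g j) ⊎ Injective _≡_ _≡_ g
  repeats-or-injective g
    with Finₚ.any? (λ i → Finₚ.any? (λ j → (toℕ i <? toℕ j) ×-dec (g i Finₚ.≟ g j)))
  ... | yes (i , j , i<j , e) = inj₁ (i , j , i<j , e)
  ... | no none = inj₂ injective
    where
    injective : Injective _≡_ _≡_ g
    injective {i} {j} e with <-cmp (toℕ i) (toℕ j)
    ... | tri< i<j _ _ = ⊥-elim (none (i , j , i<j , e))
    ... | tri≈ _ i≡j _ = Finₚ.toℕ-injective i≡j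
    ... | tri> _ _ j<i = ⊥-elim (none (j , i , j<i , sym e))

  -- A shortest odd closed walk is an odd cycle.
  noOddCycle⇒noOddClosedWalk : ∀ {n} (X : Graph Δ n) → NoOddCycle X → NoOddClosedWalk X
  noOddCycle⇒noOddClosedWalk X noCycle {L} {a} = <-rec P descend L a
    where
    P : ℕ → Set
    P L = ∀ a → WalkOf X L a a → odd L ≡ true → ⊥
    descend : ∀ L → (∀ {L′} → L′ < L → P L′) → P L
    descend L shorter a (w , walk , w0 , wL) oddL with repeats-or-injective (prefix L w)
    ... | inj₂ injective = noCycle L w walk (trans wL (sym w0)) oddL injective
    ... | inj₁ (i , j , i<j , e) with revisit X (toℕ i) (toℕ j) walk i<j (<⇒≤ (Finₚ.toℕ<n j)) e
    ... | R with odd (Revisit.loop R) in oddLoop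
    ...   | true  = shorter (loop<L (Finₚ.toℕ<n j)) (proj₁ closedWalk) (proj₂ closedWalk) oddLoop
      where open Revisit R
    ...   | false = shorter rest<L (w 0) (subst (WalkOf X rest (w 0)) (trans wL (sym w0)) shortened)
                      (trans (sym (cong (_xor odd rest) oddLoop)) (trans (sym parity) oddL))
      where open Revisit R

  shorten : ∀ {n} (X : Graph Δ n) → NoOddClosedWalk X → ∀ L {a b} → WalkOf X L a b →
    ∃ λ L′ → L′ < n × odd L′ ≡ odd L × WalkOf X L′ a b
  shorten {n} X noOdd L = <-rec P descend L
    where
    P : ℕ → Set
    P L = ∀ {a b} → WalkOf X L a b → ∃ λ L′ → L′ < n × odd L′ ≡ odd L × WalkOf X L′ a b
    descend : ∀ L → (∀ {L′} → L′ < L → P L′) → P L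
    descend L shorter {a} {b} W@(w , walk , w0 , wL) with L <? n
    ... | yes L<n = L , L<n , refl , W
    ... | no  L≮n with Finₚ.pigeonhole (n<1+n n) (prefix (suc n) w)
    ... | i , j , i<j , e = cutLoop (revisit X (toℕ i) (toℕ j) walk i<j j≤L e)
      where
      j≤L : toℕ j ≤ L
      j≤L = ≤-trans (≤-pred (Finₚ.toℕ<n j)) (≮⇒≥ L≮n)
      cutLoop : Revisit X w L (toℕ j) → ∃ λ L′ → L′ < n × odd L′ ≡ odd L × WalkOf X L′ a b
      cutLoop R =
        let L′ , L′<n , parity′ , W′ = shorter rest<L (subst₂ (WalkOf X rest) w0 wL shortened)
        in  L′ , L′<n , trans parity′ restParity , W′
        where
        open Revisit R
        loopEven : odd loop ≡ false
        loopEven with odd loop in oddLoop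
        ... | false = refl
        ... | true  = ⊥-elim (noOdd (proj₂ closedWalk) oddLoop)
        restParity : odd rest ≡ odd L
        restParity = trans (sym (cong (_xor odd rest) loopEven)) (sym parity)

  -- A graph without odd closed walks is bipartite: colour x by the parity of
  -- the walks to x from the first vertex (the root) of its component.
  module TwoColouring {n} (X : Graph Δ n) (noOdd : NoOddClosedWalk X) where

    -- a walk of length L from a to b, in a form that is decidable by recursion on L
    Walks : ℕ → Fin n → Fin n → Set
    Walks zero    a b = a ≡ b
    Walks (suc L) a b = ∃ λ z → Adj X a z × Walks L z b

    Walks? : ∀ L a b → Dec (Walks L a b)
    Walks? zero    a b = a Finₚ.≟ b
    Walks? (suc L) a b = Finₚ.any? (λ z → (is-just (adj X a z) Boolₚ.≟ true) ×-dec Walks? L z b)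

    toWalkOf : ∀ L {a b} → Walks L a b → WalkOf X L a b
    toWalkOf zero    {a} refl = (λ _ → a) , (λ k ()) , refl , refl
    toWalkOf (suc L) {a} (z , az , W) =
      let w , walk , w0 , wL = toWalkOf L W
      in  extend w , extendSteps w walk w0 , refl , wL
      where
      extend : (ℕ → Fin n) → ℕ → Fin n
      extend w zero    = a
      extend w (suc k) = w k
      extendSteps : ∀ w → IsWalk X w L → w 0 ≡ z → IsWalk X (extend w) (suc L)
      extendSteps w walk refl zero    _         = az
      extendSteps w walk w0   (suc k) (s≤s k<L) = walk k k<L

    fromWalkOf : ∀ L {a b} → WalkOf X L a b → Walks L a b
    fromWalkOf zero    (w , walk , refl , refl) = refl
    fromWalkOf (suc L) (w , walk , refl , refl) =
      w 1 , walk 0 (s≤s z≤n) ,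
      fromWalkOf L ((λ k → w (suc k)) , (λ k k<L → walk (suc k) (s≤s k<L)) , refl , refl)

    snoc : ∀ L {a b c} → Walks L a b → Adj X b c → Walks (suc L) a c
    snoc zero    refl        bc = _ , bc , refl
    snoc (suc L) (z , az , W) bc = z , az , snoc L W bc

    append : ∀ L₁ L₂ {a b c} → Walks L₁ a b → Walks L₂ b c → Walks (L₁ + L₂) a c
    append zero     L₂ refl         W′ = W′
    append (suc L₁) L₂ (z , az , W) W′ = z , az , append L₁ L₂ W W′

    reverse : ∀ L {a b} → Walks L a b → Walks L b a
    reverse zero    refl         = refl
    reverse (suc L) (z , az , W) = snoc L (reverse L W) (Adj-sym X az)

    bounded : ∀ L {a b} → Walks L a b →
      ∃ λ (L′ : Fin n) → odd (toℕ L′) ≡ odd L × Walks (toℕ L′) a b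
    bounded L W =
      let L′ , L′<n , parity , W′ = shorten X noOdd L (toWalkOf L W)
          toℕ-L′ = Finₚ.toℕ-fromℕ< L′<n
      in  fromℕ< L′<n , trans (cong odd toℕ-L′) parity ,
          subst (λ m → Walks m _ _) (sym toℕ-L′) (fromWalkOf L′ W′)

    Reachable : Fin n → Fin n → Set
    Reachable a x = ∃ λ (L : Fin n) → Walks (toℕ L) a x

    OddReachable : Fin n → Fin n → Set
    OddReachable a x = ∃ λ (L : Fin n) → odd (toℕ L) ≡ true × Walks (toℕ L) a x

    Reachable? : ∀ a x → Dec (Reachable a x)
    Reachable? a x = Finₚ.any? (λ L → Walks? (toℕ L) a x)

    OddReachable? : ∀ a x → Dec (OddReachable a x)
    OddReachable? a x = Finₚ.any? (λ L → (odd (toℕ L) Boolₚ.≟ true) ×-dec Walks? (toℕ L) a x)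

    reachable-self : ∀ x → Reachable x x
    reachable-self x = let L , _ , W = bounded 0 {x} refl in L , W

    reachable-step : ∀ {a x y} → Adj X x y → Reachable a x → Reachable a y
    reachable-step xy (L , W) = let L′ , _ , W′ = bounded _ (snoc (toℕ L) W xy) in L′ , W′

    reachable-edge : ∀ {x y} → Adj X x y → ∀ a → does (Reachable? a x) ≡ does (Reachable? a y)
    reachable-edge {x} {y} xy a with Reachable? a x | Reachable? a y
    ... | yes _  | yes _  = refl
    ... | no  _  | no  _  = refl
    ... | yes rx | no ¬ry = ⊥-elim (¬ry (reachable-step xy rx))
    ... | no ¬rx | yes ry = ⊥-elim (¬rx (reachable-step (Adj-sym X xy) ry))

    root : Fin n → Maybe (Fin n)
    root x = first (λ a → does (Reachable? a x))

    parityFrom : Maybe (Fin n) → Fin n → Bool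
    parityFrom (just r) x = does (OddReachable? r x)
    parityFrom nothing  x = false

    colour : Fin n → Bool
    colour x = parityFrom (root x) x

    -- Adjacent vertices reachable from r have different parities from r:
    -- equal parities would close up an odd walk through r.
    parity-flips : ∀ r x y → Reachable r x → Adj X x y →
      does (OddReachable? r x) ≡ does (OddReachable? r y) → ⊥
    parity-flips r x y rx xy same with OddReachable? r x | OddReachable? r y
    ... | yes (L₁ , odd₁ , W₁) | yes (L₂ , odd₂ , W₂) =
      noOdd (toWalkOf _ (append (suc (toℕ L₁)) (toℕ L₂) (snoc (toℕ L₁) W₁ xy)
                                (reverse (toℕ L₂) W₂)))
            (trans (cong not (odd-+ (toℕ L₁) (toℕ L₂))) (cong₂ (λ p q → not (p xor q)) odd₁ odd₂))
    ... | no ¬ox | no ¬oy with rx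
    ...   | L₁ , W₁ with odd (toℕ L₁) in odd₁
    ...     | true  = ¬ox (L₁ , odd₁ , W₁)
    ...     | false =
      let L′ , parity , W′ = bounded (suc (toℕ L₁)) (snoc (toℕ L₁) W₁ xy)
      in  ¬oy (L′ , trans parity (cong not odd₁) , W′)
    parity-flips r x y rx xy () | yes _ | no _
    parity-flips r x y rx xy () | no _  | yes _

    proper : ∀ x y → Adj X x y → colour x ≢ colour y
    proper x y xy same with root y in rooty
    ... | nothing = first-complete (λ a → does (Reachable? a y))
                                   (dec-true (Reachable? y y) (reachable-self y)) rooty
    ... | just r  = parity-flips r x y rx xy
                      (subst (λ s → parityFrom s x ≡ does (OddReachable? r y)) sameRoot same)
      where
      sameRoot : root x ≡ just r
      sameRoot = trans (first-cong (reachable-edge xy)) rooty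
      rx : Reachable r x
      rx with Reachable? r x | first-sound (λ a → does (Reachable? a x)) sameRoot
      ... | yes r⇝x | _ = r⇝x

    bipartite : Bipartite X
    bipartite = colour , proper

module Characterisation (Δ : EdgeKind) (Π : Property {Δ})
  (isoClosed : IsoClosed Π) (extendible : StronglyHalfExtendible Π)
  (hereditary : Hereditary Π) (noTriangle : ∀ (G : Graph Δ 3) → UnderlyingK3 G → Π G → ⊥) where

  open Sums Δ
  open Graphs Δ
  open OddWalks Δ

  inclusive₁ : ∀ (G : Graph Δ 1) → Π G
  inclusive₁ = proj₁ (proj₁ extendible)

  blockAdditive : BlockAdditive Π
  blockAdditive = proj₁ (proj₂ extendible)

  extension : StrongHalfSubgraphExtension Π
  extension = proj₂ (proj₂ extendible)

  Π-cast : ∀ {L L′} (e : L′ ≡ L) (X : Graph Δ L) (Y : Graph Δ L′) →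
    (∀ i j → adj Y i j ≡ adj X (subst Fin e i) (subst Fin e j)) → Π X → Π Y
  Π-cast refl X Y same = isoClosed X Y Perm.id same

  Π-single : ∀ {L} → L ≡ 1 → (Y : Graph Δ L) → Π Y
  Π-single refl = inclusive₁

  no-triangle : ∀ {L} → L ≡ 3 → (Y : Graph Δ L) → (∀ i j → i ≢ j → Adj Y i j) → ¬ Π Y
  no-triangle refl = noTriangle

  record ApexExtension {m} (X : Graph Δ m) (f : Fin m → Maybe Label) : Set where
    field
      κ      : Fin m → Bool
      enough : ∑ m (λ i → 𝟙 (is-just (f i))) ≤ 2 * ∑ m (λ i → 𝟙 (is-just (f i) ∧ κ i))
      Πcone  : Π (cone X (restrict f κ))

  coneExtension : ∀ {m} (X : Graph Δ m) (f : Fin m → Maybe Label) → Π X → ApexExtension X f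
  coneExtension {m} X f ΠX =
    let keep , enough , Πrest = extension (cone X f) U ΠU ΠW
    in  record
        { κ      = λ i → keep (suc i) zero
        ; enough = subst₂ (λ c k → c ≤ 2 * k) (cone-crossEdges X f) (cone-keptEdges X f keep) enough
        ; Πcone  = isoClosed _ _ Perm.id (cone-deleteCross X f keep) Πrest
        }
    where
    U : Subset (suc m)
    U = oldVertices m
    ΠU : Π (induced (cone X f) U)
    ΠU = Π-cast (size⊤ m) X (induced (cone X f) U) (λ i j → cong₂ (adj X) (enum⊤ m i) (enum⊤ m j)) ΠX
    ΠW : Π (induced (cone X f) (∁ U))
    ΠW = Π-single (cong suc (size∁⊤ m)) _

  -- If the apex of a cone is joined to both ends of an edge ab, the cone is not
  -- in Π: the apex, a and b induce a triangle.
  apex-no-triangle : ∀ {n} (X : Graph Δ n) (f : Fin n → Maybe Label) {a b} →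
    is-just (f a) ≡ true → is-just (f b) ≡ true → Adj X a b → ¬ Π (cone X f)
  apex-no-triangle {n} X f {a} {b} fa fb ab Πcone =
    no-triangle size≡3 (induced (cone X f) S) complete (hereditary (cone X f) S Πcone)
    where
    onEdge : Fin n → Bool
    onEdge x = (x ≡ᵇ a) ∨ (x ≡ᵇ b)
    S : Subset (suc n)
    S = true ∷ tabulate onEdge
    count : ∀ x → 𝟙 (onEdge x) ≡ 𝟙 (x ≡ᵇ a) + 𝟙 (x ≡ᵇ b)
    count x with x ≡ᵇ a in x≡a
    ... | false = refl
    ... | true
      rewrite ≡ᵇ-false x b (λ x≡b → Adj⇒≢ X ab (trans (sym (≡ᵇ-sound x a x≡a)) x≡b)) = refl
    size≡3 : size {Δ} S ≡ 3
    size≡3 = cong suc (trans (size-tabulate n onEdge)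
               (trans (∑-cong n count) (trans (∑-+ n _ _) (cong₂ _+_ (∑-single n a) (∑-single n b)))))
    member : ∀ x → lookup S (suc x) ≡ true → (x ≡ a) ⊎ (x ≡ b)
    member x x∈S
      with (x ≡ᵇ a) in x≡a | (x ≡ᵇ b) in x≡b | trans (sym (Vecₚ.lookup∘tabulate onEdge x)) x∈S
    ... | true  | _    | _ = inj₁ (≡ᵇ-sound x a x≡a)
    ... | false | true | _ = inj₂ (≡ᵇ-sound x b x≡b)
    attached : ∀ x → lookup S (suc x) ≡ true → is-just (f x) ≡ true
    attached x x∈S with member x x∈S
    ... | inj₁ refl = fa
    ... | inj₂ refl = fb
    adjacent : ∀ p q → lookup S p ≡ true → lookup S q ≡ true → p ≢ q → Adj (cone X f) p q
    adjacent zero    zero    _   _   p≢q = ⊥-elim (p≢q refl)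
    adjacent zero    (suc y) _   y∈S _   = attached y y∈S
    adjacent (suc x) zero    x∈S _   _   = trans (is-just-map (rev Δ) (f x)) (attached x x∈S)
    adjacent (suc x) (suc y) x∈S y∈S p≢q with member x x∈S | member y y∈S
    ... | inj₁ refl | inj₁ refl = ⊥-elim (p≢q refl)
    ... | inj₂ refl | inj₂ refl = ⊥-elim (p≢q refl)
    ... | inj₁ refl | inj₂ refl = ab
    ... | inj₂ refl | inj₁ refl = Adj-sym X ab
    complete : ∀ i j → i ≢ j → Adj (induced (cone X f) S) i j
    complete i j i≢j = adjacent (enum S i) (enum S j) (enum-∈ S i) (enum-∈ S j)
                                (λ e → i≢j (enum-injective S e))

  kept-independent : ∀ {n} (X : Graph Δ n) (f : Fin n → Maybe Label) (κ : Fin n → Bool) →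
    Π (cone X (restrict f κ)) → ∀ {a b} → Adj X a b →
    is-just (f a) ≡ true → is-just (f b) ≡ true → 𝟙 (κ a) + 𝟙 (κ b) ≤ 1
  kept-independent X f κ Πcone {a} {b} ab fa fb with κ a in κa | κ b in κb
  ... | true  | true  = ⊥-elim (apex-no-triangle X (restrict f κ) (kept κa fa) (kept κb fb) ab Πcone)
    where
    kept : ∀ {x} → κ x ≡ true → is-just (f x) ≡ true → is-just (restrict f κ x) ≡ true
    kept κx fx rewrite κx = fx
  ... | true  | false = s≤s z≤n
  ... | false | true  = s≤s z≤n
  ... | false | false = z≤n

  -- Join an apex to the L vertices of a
  -- cycle and extend: at least L/2 apex edges are kept, and no two of them
  -- end at consecutive cycle vertices (a triangle), so exactly L/2 are kept.
  noOddCycle : ∀ {n} (X : Graph Δ n) → Π X → NoOddCycle X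
  noOddCycle X ΠX zero w walk closed () injective
  noOddCycle {n} X ΠX L@(suc _) w walk closed oddL injective =
    ⊥-elim (false≢true (trans (sym (odd-double T)) (trans (cong odd (sym L≡2T)) oddL)))
    where
    onCycle : Fin L → Fin n
    onCycle = prefix L w
    f : Fin n → Maybe Label
    f x = if x ∈image onCycle then just (label X (walk 0 (s≤s z≤n))) else nothing
    open ApexExtension (coneExtension X f ΠX)
    b : ℕ → ℕ
    b k = 𝟙 (κ (w k))
    T : ℕ
    T = ∑ₙ L b
    attached : ∀ x → is-just (f x) ≡ (x ∈image onCycle)
    attached x with x ∈image onCycle
    ... | true  = refl
    ... | false = refl
    apexDegree : ∑ n (λ x → 𝟙 (is-just (f x))) ≡ L
    apexDegree = begin
      ∑ n (λ x → 𝟙 (is-just (f x)))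
        ≡⟨ ∑-cong n (λ x → cong 𝟙 (trans (attached x) (sym (∧-identityʳ _)))) ⟩
      ∑ n (λ x → 𝟙 ((x ∈image onCycle) ∧ true))  ≡⟨ ∑-image L onCycle injective (λ _ → true) ⟩
      ∑ L (λ i → 1)                              ≡⟨ ∑-toℕ L (λ _ → 1) ⟩
      ∑ₙ L (λ _ → 1)                             ≡⟨ ∑ₙ-ones L ⟩
      L                                          ∎
      where open ≡-Reasoning
    keptDegree : ∑ n (λ x → 𝟙 (is-just (f x) ∧ κ x)) ≡ T
    keptDegree = trans (∑-cong n (λ x → cong (λ z → 𝟙 (z ∧ κ x)) (attached x)))
                       (trans (∑-image L onCycle injective κ) (∑-toℕ L b))
    onCycle-attached : ∀ k → k ≤ L → is-just (f (w k)) ≡ true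
    onCycle-attached k k≤L = trans (attached (w k)) (closed-visits w closed k k≤L)
    consecutive : ∀ k → k < L → b k + b (suc k) ≤ 1
    consecutive k k<L = kept-independent X f κ Πcone (walk k k<L)
                          (onCycle-attached k (<⇒≤ k<L)) (onCycle-attached (suc k) k<L)
    L≡2T : L ≡ T + T
    L≡2T = ≤-antisym
      (subst (L ≤_) (cong (T +_) (+-identityʳ T))
        (subst₂ (λ c k → c ≤ 2 * k) apexDegree keptDegree enough))
      (cyclic-packing L b (cong (λ z → 𝟙 (κ z)) closed) consecutive)

  Π⇒bipartite : ∀ {n} (X : Graph Δ n) → Π X → Bipartite X
  Π⇒bipartite X ΠX = TwoColouring.bipartite X (noOddCycle⇒noOddClosedWalk X (noOddCycle X ΠX))

  -- Hanging a leaf at a vertex a preserves Π: of the single cross edge at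
  -- least half, hence all, must be kept.
  pendant : ∀ {m} (X : Graph Δ m) (d : Label) (a : Fin m) → Π X → Π (cone X (edgeTo d a))
  pendant {m} X d a ΠX =
    isoClosed _ _ Perm.id (cone-cong X (λ j → sym (unchanged j))) Πcone
    where
    f : Fin m → Maybe Label
    f = edgeTo d a
    open ApexExtension (coneExtension X f ΠX)
    attached : ∀ j → is-just (f j) ≡ (j ≡ᵇ a)
    attached j = is-just-if (j ≡ᵇ a) d
    κa : κ a ≡ true
    κa with κ a in e | subst₂ (λ c k → c ≤ 2 * k)
           (trans (∑-cong m (λ j → cong 𝟙 (attached j))) (∑-single m a))
           (trans (∑-cong m (λ j → cong (λ z → 𝟙 (z ∧ κ j)) (attached j))) (∑-single∧ m a κ))
           enough
    ... | true  | _ = refl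
    ... | false | ()
    unchanged : ∀ j → restrict f κ j ≡ f j
    unchanged j with j ≡ᵇ a in j≡a
    ... | true rewrite ≡ᵇ-sound j a j≡a | κa = refl
    ... | false with κ j
    ...   | true  = refl
    ...   | false = refl

  Π-leaves : ∀ {m} (X : Graph Δ m) d a k → Π X → Π (leaves X d a k)
  Π-leaves X d a zero    ΠX = ΠX
  Π-leaves X d a (suc k) ΠX = pendant (leaves X d a k) d (k ↑ʳ a) (Π-leaves X d a k ΠX)

  -- Let v = 0 be a vertex of a bipartite G
  -- such that G - v ∈ Π is connected, and let n₀ be a neighbour of v.  Hang at
  -- n₀ one leaf for each other neighbour of v, and extend across the cut
  -- between this graph and a copy of v joined to the old neighbours of v and
  -- to those leaves.  A kept old edge together with a kept leaf edge would
  -- close an odd cycle through n₀, so one kind is dropped entirely; counting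
  -- shows that all old edges are kept, and the copy of v with the old
  -- vertices induces G.
  module AddVertex {m} (G : Graph Δ (suc m)) (bipartiteG : Bipartite G)
                   (ΠG-v : Π (reindex G suc)) (connected : ConnectedIn G (⊤ - zero))
                   (n₀ : Fin m) (v~n₀ : Adj G zero (suc n₀)) where

    N N′ : Fin m → Bool
    N u  = is-just (adj G zero (suc u))
    N′ u = N u ∧ not (u ≡ᵇ n₀)

    d₀ : Label
    d₀ = label G v~n₀

    -- G - v with m leaves at n₀; leaf u is u ↑ˡ m and the old vertex u is m ↑ʳ u
    base : Graph Δ (m + m)
    base = leaves (reindex G suc) d₀ n₀ m

    attach : Fin (m + m) → Maybe Label
    attach x =
      [ (λ u → if N′ u then just d₀ else nothing) , (λ u → adj G zero (suc u)) ]′ (splitAt m x)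

    attach-leaf : ∀ u → is-just (attach (u ↑ˡ m)) ≡ N′ u
    attach-leaf u rewrite Finₚ.splitAt-↑ˡ m u m = is-just-if (N′ u) d₀

    attach-old : ∀ u → attach (m ↑ʳ u) ≡ adj G zero (suc u)
    attach-old u rewrite Finₚ.splitAt-↑ʳ m m u = refl

    open ApexExtension (coneExtension base attach (Π-leaves (reindex G suc) d₀ n₀ m ΠG-v))

    R : Graph Δ (suc (m + m))
    R = cone base (restrict attach κ)

    oldKept leafKept : Fin m → Bool
    oldKept u  = N u ∧ κ (m ↑ʳ u)
    leafKept u = N′ u ∧ κ (u ↑ˡ m)

    D′ D A B : ℕ
    D′ = ∑ m (λ u → 𝟙 (N′ u))
    D  = ∑ m (λ u → 𝟙 (N u))
    A  = ∑ m (λ u → 𝟙 (oldKept u))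
    B  = ∑ m (λ u → 𝟙 (leafKept u))

    degree : D ≡ suc D′
    degree = trans (∑-cong m split)
               (trans (∑-+ m _ _) (trans (cong (D′ +_) (∑-single m n₀)) (+-comm D′ 1)))
      where
      split : ∀ u → 𝟙 (N u) ≡ 𝟙 (N′ u) + 𝟙 (u ≡ᵇ n₀)
      split u with u ≡ᵇ n₀ in u≡n₀
      ... | true rewrite ≡ᵇ-sound u n₀ u≡n₀ | v~n₀ = refl
      ... | false with N u
      ...   | true  = refl
      ...   | false = refl

    budget : D′ + D ≤ 2 * (B + A)
    budget = subst₂ (λ c k → c ≤ 2 * k) cross kept enough
      where
      cross : ∑ (m + m) (λ x → 𝟙 (is-just (attach x))) ≡ D′ + D
      cross = trans (∑-split m m _) (cong₂ _+_
        (∑-cong m (λ u → cong 𝟙 (attach-leaf u)))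
        (∑-cong m (λ u → cong (λ z → 𝟙 (is-just z)) (attach-old u))))
      kept : ∑ (m + m) (λ x → 𝟙 (is-just (attach x) ∧ κ x)) ≡ B + A
      kept = trans (∑-split m m _) (cong₂ _+_
        (∑-cong m (λ u → cong (λ z → 𝟙 (z ∧ κ (u ↑ˡ m))) (attach-leaf u)))
        (∑-cong m (λ u → cong (λ z → 𝟙 (is-just z ∧ κ (m ↑ʳ u))) (attach-old u))))

    embed : Fin (suc m) → Fin (suc (m + m))
    embed zero    = zero
    embed (suc u) = suc (m ↑ʳ u)

    leaf : Fin m → Fin (suc (m + m))
    leaf u = suc (u ↑ˡ m)

    adj-old : ∀ a b → adj R (embed (suc a)) (embed (suc b)) ≡ adj G (suc a) (suc b)
    adj-old a b = leaves-old (reindex G suc) d₀ n₀ m a b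

    apex-edge : ∀ x → κ x ≡ true → is-just (attach x) ≡ true → Adj R zero (suc x)
    apex-edge x kept attached rewrite kept = attached

    colour : Fin (suc (m + m)) → Bool
    colour = proj₁ (Π⇒bipartite R Πcone)

    colour-proper : ∀ x y → Adj R x y → colour x ≢ colour y
    colour-proper = proj₂ (Π⇒bipartite R Πcone)

    -- In R all neighbours of v get the colour of n₀, since G - v is connected
    -- and its 2-colouring is unique up to a swap.
    sameColour : ∀ u → N u ≡ true → colour (embed (suc u)) ≡ colour (embed (suc n₀))
    sameColour u Nu = xor-cancelˡ {proj₁ bipartiteG (suc u)} (trans
      (colourings-agree G (⊤ - zero) cG (λ x → colour (embed x)) proper connected
                        (inside u) (inside n₀))
      (cong (_xor colour (embed (suc n₀))) (both-differ (v≁ n₀ v~n₀) (v≁ u Nu))))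
      where
      cG : Fin (suc m) → Bool
      cG = proj₁ bipartiteG
      v≁ : ∀ w → Adj G zero (suc w) → cG (suc w) ≢ cG zero
      v≁ w v~w e = proj₂ bipartiteG zero (suc w) v~w (sym e)
      inside : ∀ w → suc w ∈ (⊤ - zero)
      inside w = x∈p∧x≢y⇒x∈p-y {y = zero} ∈⊤ (λ ())
      v∉ : zero ∉ (⊤ {suc m} - zero)
      v∉ ()
      proper : ∀ x y → x ∈ (⊤ - zero) → y ∈ (⊤ - zero) → Adj G x y →
        cG x ≢ cG y × colour (embed x) ≢ colour (embed y)
      proper zero    _       x∈ _  _  = ⊥-elim (v∉ x∈)
      proper (suc a) zero    _  y∈ _  = ⊥-elim (v∉ y∈)
      proper (suc a) (suc b) _  _  ab =
        proj₂ bipartiteG (suc a) (suc b) ab ,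
        colour-proper (embed (suc a)) (embed (suc b)) (trans (cong is-just (adj-old a b)) ab)

    -- A kept old edge v–u and a kept leaf edge v–l: the colours of v and l both
    -- differ from that of n₀, yet v and l are adjacent.
    conflict : ∀ {u l} → oldKept u ≡ true → leafKept l ≡ true → ⊥
    conflict {u} {l} u-kept l-kept =
      colour-proper zero (leaf l) v~l (both-differ v≢n₀ l≢n₀)
      where
      Nu : N u ≡ true
      Nu = proj₁ (∧-split u-kept)
      v~u : Adj R zero (embed (suc u))
      v~u = apex-edge (m ↑ʳ u) (proj₂ (∧-split u-kept)) (trans (cong is-just (attach-old u)) Nu)
      v~l : Adj R zero (leaf l)
      v~l = apex-edge (l ↑ˡ m) (proj₂ (∧-split l-kept)) (trans (attach-leaf l) (proj₁ (∧-split l-kept)))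
      v≢n₀ : colour zero ≢ colour (embed (suc n₀))
      v≢n₀ e = colour-proper zero (embed (suc u)) v~u (trans e (sym (sameColour u Nu)))
      l≢n₀ : colour (leaf l) ≢ colour (embed (suc n₀))
      l≢n₀ = colour-proper (leaf l) (embed (suc n₀)) (leaves-leaf (reindex G suc) d₀ n₀ m l)

    oneKindKept : A ≡ 0 ⊎ B ≡ 0
    oneKindKept with A ≟ 0 | B ≟ 0
    ... | yes A≡0 | _       = inj₁ A≡0
    ... | no  _   | yes B≡0 = inj₂ B≡0
    ... | no  A≢0 | no  B≢0 =
      let u , u-kept = ∑-witness m _ A≢0
          l , l-kept = ∑-witness m _ B≢0
      in  ⊥-elim (conflict (𝟙≢0 u-kept) (𝟙≢0 l-kept))

    allOldKept : ∀ u → N u ≡ true → κ (m ↑ʳ u) ≡ true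
    allOldKept u = 𝟙-∧-full (∑-tight m (λ u → 𝟙 (oldKept u)) (λ u → 𝟙 (N u))
                               (λ u → 𝟙-mono (λ e → proj₁ (∧-split e))) (≤-reflexive (sym A≡D)) u)
      where
      A≡D : A ≡ D
      A≡D = trans (half-majority B≤D′ (subst (A ≤_) degree A≤D)
                                 (subst (λ d → D′ + d ≤ 2 * (B + A)) degree budget) oneKindKept)
                  (sym degree)
        where
        B≤D′ : B ≤ D′
        B≤D′ = ∑-mono m (λ u → 𝟙-mono (λ e → proj₁ (∧-split e)))
        A≤D : A ≤ D
        A≤D = ∑-mono m (λ u → 𝟙-mono (λ e → proj₁ (∧-split e)))

    adj-embed : ∀ a b → adj R (embed a) (embed b) ≡ adj G a b
    adj-embed zero    zero    = sym (irrefl G zero)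
    adj-embed zero    (suc u) = apex u
      where
      apex : ∀ u → restrict attach κ (m ↑ʳ u) ≡ adj G zero (suc u)
      apex u with κ (m ↑ʳ u) in kept
      ... | true  = attach-old u
      ... | false with adj G zero (suc u) in e
      ...   | nothing = refl
      ...   | just _  = ⊥-elim (false≢true (trans (sym kept) (allOldKept u (cong is-just e))))
    adj-embed (suc u) zero    =
      trans (cong (Maybe.map (rev Δ)) (adj-embed zero (suc u))) (sym (sym-adj G zero (suc u)))
    adj-embed (suc a) (suc b) = adj-old a b

    S : Subset (suc (m + m))
    S = true ∷ pad m ⊤

    size-S : size {Δ} S ≡ suc m
    size-S = cong suc (trans (size-pad m ⊤) (size⊤ m))

    enum-S : ∀ i → enum {Δ} S i ≡ embed (subst Fin size-S i)
    enum-S zero    = sym (cong embed (subst-zero (trans (size-pad m ⊤) (size⊤ m))))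
    enum-S (suc i) = trans (cong suc (trans (enum-pad m ⊤ i)
        (cong (m ↑ʳ_) (trans (enum⊤ m _) (subst-subst (size-pad m ⊤))))))
      (sym (cong embed (subst-suc (trans (size-pad m ⊤) (size⊤ m)) i)))

    ΠG : Π G
    ΠG = Π-cast (sym size-S) (induced R S) G same (hereditary R S Πcone)
      where
      back : ∀ i → enum {Δ} S (subst Fin (sym size-S) i) ≡ embed i
      back i = trans (enum-S _) (cong embed (subst-subst-sym size-S))
      same : ∀ i j →
        adj G i j ≡ adj R (enum S (subst Fin (sym size-S) i)) (enum S (subst Fin (sym size-S) j))
      same i j = sym (trans (cong₂ (adj R) (back i) (back j)) (adj-embed i j))

  -- A graph that is a single block, all of whose smaller bipartite graphs are
  -- in Π, is in Π: vertex 0 has a neighbour and G - 0 is connected.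
  wholeBlock : ∀ {n} (G : Graph Δ n) → Bipartite G → IsBlock G ⊤ →
    (∀ {n′} → n′ < n → (G′ : Graph Δ n′) → Bipartite G′ → Π G′) → Π G
  wholeBlock {zero}        G _   ((() , _) , _) _
  wholeBlock {suc zero}    G _   _              _       = inclusive₁ G
  wholeBlock {suc (suc m)} G bip (_ , connected , noCutVertex , _) smaller
    with connected zero (suc zero) ∈⊤ ∈⊤
  ... | step _ v~x _ = viaNeighbour _ v~x
    where
    viaNeighbour : ∀ x → Adj G zero x → Π G
    viaNeighbour zero     v~v  = ⊥-elim (Adj-irrefl G v~v)
    viaNeighbour (suc n₀) v~n₀ =
      AddVertex.ΠG G bip (smaller (n<1+n _) (reindex G suc) (bipartite-reindex G suc bip))
                   (noCutVertex zero ∈⊤) n₀ v~n₀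

  -- Bipartite graphs are in Π, by induction on the number of vertices: by
  -- block additivity it suffices that every block is in Π; proper blocks are
  -- smaller, and a graph that is a block itself is handled by wholeBlock.
  bipartite⇒Π : ∀ {n} (G : Graph Δ n) → Bipartite G → Π G
  bipartite⇒Π {n} = <-rec P induct n
    where
    P : ℕ → Set
    P n = (G : Graph Δ n) → Bipartite G → Π G
    induct : ∀ n → (∀ {n′} → n′ < n → P n′) → P n
    induct n smaller G bip = proj₂ (blockAdditive G) blocks
      where
      blocks : ∀ S → IsBlock G S → Π (induced G S)
      blocks S isBlock with Vecₚ.≡-dec Boolₚ._≟_ S ⊤
      ... | yes refl = hereditary G ⊤ (wholeBlock G bip isBlock smaller)
      ... | no  S≢⊤  = smaller (≤∧≢⇒< (size≤ S) (λ e → S≢⊤ (size-full S e)))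
                               (induced G S) (bipartite-reindex G (enum S) bip)

mainTheorem4 : (Δ : EdgeKind) (Π : Property {Δ}) →
    IsoClosed Π → StronglyHalfExtendible Π → Hereditary Π →
    (∀ (G : Graph Δ 3) → UnderlyingK3 G → Π G → ⊥) →
    ∀ {n} (G : Graph Δ n) → (Π G → Bipartite G) × (Bipartite G → Π G)
mainTheorem4 Δ Π isoClosed extendible hereditary noTriangle G =
  Π⇒bipartite G , bipartite⇒Π G
  where open Characterisation Δ Π isoClosed extendible hereditary noTriangle
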